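{- Let $a$ be an integer. Then $$\mathbf{C}\!\left(\frac{1+ax}{1-x^3}\right)=(1-x)\,c(x)\cdot\mathbf{C}\!\left(\frac{1+ax}{1-x^2}\right),$$ where $\mathbf{C}$ is the central transform (defined in the context) and $c(x)=\frac{1-\sqrt{1-4x}}{2x}$.
   Context: For a power series $g(x)\in\mathbb{Z}[[x]]$ with $g(0)=1$, let $t_{n,k}=[x^n]\,\frac{1}{1-x}\,\frac{1}{g\left(\frac{x}{1-x}\right)}\left(\frac{x}{1-x}\right)^k$ for $n,k\ge0$, where $[x^n]$ extracts the coefficient of $x^n$. The central transform $\mathbf{C}(g(x))$ is the power series $\sum_{n\ge0}b_nx^n$ with $b_n=t_{2n,n}$. -}

module Defs where

open import Data.Nat as ℕ using (ℕ; zero; suc; _≡ᵇ_; _∸_)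
open import Data.Nat.Combinatorics using (_C_)
open import Data.Nat.DivMod using (_/_)
open import Data.Integer as ℤ using (ℤ; +_; _+_; _*_; -_)
open import Data.Bool using (if_then_else_)

Series : Set
Series = ℕ → ℤ

sumTo : (ℕ → ℤ) → ℕ → ℤ
sumTo f zero    = f zero
sumTo f (suc n) = sumTo f n + f (suc n)

_⊛_ : Series → Series → Series
(f ⊛ g) n = sumTo (λ i → f i * g (n ∸ i)) n
infixl 7 _⊛_

one : Series
one zero    = + 1
one (suc _) = + 0

pow : Series → ℕ → Series
pow f zero    = one
pow f (suc k) = f ⊛ pow f k

open import Data.List using (List; []; _∷_)
poly : List ℤ → Series
poly []       n       = + 0
poly (c ∷ cs) zero    = c
poly (c ∷ cs) (suc n) = poly cs n

-- Multiplicative inverse of a series g with g(0) = 1 (the value g 0 is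
-- not inspected; it is assumed to be 1).  invAux g n is correct on indices ≤ n.
invAux : Series → ℕ → Series
invAux g zero    m = if m ≡ᵇ 0 then + 1 else + 0
invAux g (suc n) m =
  if m ≡ᵇ suc n
  then - sumTo (λ j → g (suc j) * invAux g n (n ∸ j)) n
  else invAux g n m

inv : Series → Series
inv g n = invAux g n n

geom : Series
geom _ = + 1

u : Series
u zero    = + 0
u (suc _) = + 1

-- composition g(x/(1-x)) = Σ_k g_k (x/(1-x))^k  (finite in each degree since u(0)=0)
compU : Series → Series
compU g n = sumTo (λ k → g k * pow u k n) n

t : Series → ℕ → ℕ → ℤ
t g n k = (geom ⊛ inv (compU g) ⊛ pow u k) n

centralTransform : Series → Series
centralTransform g n = t g (2 ℕ.* n) n

-- Catalan generating function c(x) = (1 - √(1-4x))/(2x) = Σ_n (2n choose n)/(n+1) x^n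
catalan : Series
catalan n = + (((2 ℕ.* n) C n) / suc n)

g₃ : ℤ → Series
g₃ a = poly (+ 1 ∷ a ∷ []) ⊛ inv (poly (+ 1 ∷ + 0 ∷ + 0 ∷ - + 1 ∷ []))

g₂ : ℤ → Series
g₂ a = poly (+ 1 ∷ a ∷ []) ⊛ inv (poly (+ 1 ∷ + 0 ∷ - + 1 ∷ []))

oneMinusX : Series
oneMinusX = poly (+ 1 ∷ - + 1 ∷ [])

-- The central coefficients t(2n, n) of a triangle are read off by the linear map
-- central F n = [x^(2n)] F(x) u(x)^n with u = x/(1-x), applied to the first column
-- F = 1/((1-x) g(u)). Pascal's rule for the columns of F u^k together with the Catalan
-- equation w = x + w², w = x c(x), gives central (x F) = w · central F, hence also
-- central ((1-x) F) = (1-w) · central F. For g = (1+ax)/(1-x^(j+1)) one has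
-- (1-x)^(j+1) (1-x+ax) F = (1-x)^(j+1) - x^(j+1), so
-- (1-w)^(j+1) (1-w+aw) C(g) = ((1-w)^(j+1) - w^(j+1)) β with β = central 1.
-- Comparing j = 2 with j = 1, using (1-w) c = 1 and (1-x)((1-w)² - w²) = (1-w)³ - w³
-- (a consequence of w² = w - x), both sides agree after multiplication by the
-- invertible series (1-w)³(1-w+aw). The Catalan equation c = 1 + x c² itself comes from
-- the recurrence (n+2) c(n+1) = (4n+2) c(n): the defect E = c - 1 - x c² satisfies
-- (θ + 1) E = 4 x θ E with θ = x d/dx, and this forces E = 0.

module Submission where

open import Defs
open import Data.Nat as ℕ using (ℕ; zero; suc; _∸_; _≤_; _<_; z≤n; s≤s)
import Data.Nat.Properties as ℕP
import Data.Nat.Tactic.RingSolver as ℕ-Solver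
open import Data.Product using (_,_)
open import Data.List using (List; []; _∷_)
open import Data.Bool using (true; false; T)
open import Data.Unit using (tt)
open import Data.Sum using (inj₁; inj₂)
open import Data.Maybe using (Maybe; just; nothing)
open import Level using (0ℓ)
open import Relation.Nullary using (yes; no; contradiction)
open import Relation.Binary.PropositionalEquality
import Relation.Binary.Reasoning.Setoid as SetoidReasoning
open import Algebra.Bundles using (CommutativeRing)
open import Algebra.Solver.Ring.AlmostCommutativeRing using (fromCommutativeRing; _-Raw-AlmostCommutative⟶_)
import Algebra.Solver.Ring as RingSolver
import Algebra.Construct.Pointwise ℕ as Pointwise

module CatalanNumbers where

  open import Data.Nat using (_+_; _*_)
  open import Data.Nat.Combinatorics using (_C_; nC1≡n; nCk≡nC[n∸k]; nCk+nC[k+1]≡[n+1]C[k+1])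
  open import Data.Nat.DivMod using (_/_; m*[n/m]≡n)
  open import Data.Nat.Divisibility using (divides)

  C-absorb : ∀ n k → suc k * (suc n C suc k) ≡ suc n * (n C k)
  C-absorb n       zero    = trans (ℕP.*-identityˡ _) (trans (nC1≡n (suc n)) (sym (ℕP.*-identityʳ (suc n))))
  C-absorb zero    (suc k) = ℕP.*-zeroʳ (suc (suc k))
  C-absorb (suc n) (suc k) = begin
    suc (suc k) * (suc (suc n) C suc (suc k))  ≡⟨ cong (suc (suc k) *_) (nCk+nC[k+1]≡[n+1]C[k+1] (suc n) (suc k)) ⟨
    suc (suc k) * (A + B)                       ≡⟨ expand k A B ⟩
    A + (suc k * A + suc (suc k) * B)           ≡⟨ cong (λ z → A + z) (cong₂ _+_ (C-absorb n k) (C-absorb n (suc k))) ⟩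
    A + (suc n * (n C k) + suc n * (n C suc k)) ≡⟨ cong (λ z → A + z) (ℕP.*-distribˡ-+ (suc n) (n C k) (n C suc k)) ⟨
    A + suc n * (n C k + n C suc k)             ≡⟨ cong (λ z → A + suc n * z) (nCk+nC[k+1]≡[n+1]C[k+1] n k) ⟩
    suc (suc n) * A                             ∎
    where
    open ≡-Reasoning
    A = suc n C suc k
    B = suc n C suc (suc k)
    expand : ∀ k a b → suc (suc k) * (a + b) ≡ a + (suc k * a + suc (suc k) * b)
    expand = ℕ-Solver.solve-∀

  catalanℕ : ℕ → ℕ
  catalanℕ n = ((2 * n) C n) / suc n

  -- (n+1) divides C(2n,n) since C(2n,n) = (n+1)(C(2n,n) - C(2n,n+1)).
  suc-*-catalanℕ : ∀ n → suc n * catalanℕ n ≡ (2 * n) C n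
  suc-*-catalanℕ n = m*[n/m]≡n (divides (a ∸ b) a≡[a∸b]*[1+n])
    where
    open ≡-Reasoning
    a = (2 * n) C n
    b = (2 * n) C suc n
    [1+n]*b≡n*a : suc n * b ≡ n * a
    [1+n]*b≡n*a = ℕP.+-cancelˡ-≡ (suc n * a) _ _ (begin
      suc n * a + suc n * b            ≡⟨ ℕP.*-distribˡ-+ (suc n) a b ⟨
      suc n * (a + b)                  ≡⟨ cong (suc n *_) (nCk+nC[k+1]≡[n+1]C[k+1] (2 * n) n) ⟩
      suc n * (suc (2 * n) C suc n)    ≡⟨ C-absorb (2 * n) n ⟩
      suc (2 * n) * a                  ≡⟨ split n a ⟩
      suc n * a + n * a                ∎)
      where
      split : ∀ n a → suc (2 * n) * a ≡ suc n * a + n * a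
      split = ℕ-Solver.solve-∀
    a≡[a∸b]*[1+n] : a ≡ (a ∸ b) * suc n
    a≡[a∸b]*[1+n] = begin
      a                      ≡⟨ ℕP.m+n∸n≡m a (n * a) ⟨
      suc n * a ∸ n * a      ≡⟨ cong (suc n * a ∸_) [1+n]*b≡n*a ⟨
      suc n * a ∸ suc n * b  ≡⟨ ℕP.*-distribˡ-∸ (suc n) a b ⟨
      suc n * (a ∸ b)        ≡⟨ ℕP.*-comm (suc n) (a ∸ b) ⟩
      (a ∸ b) * suc n        ∎

  central-binomial-rec : ∀ n → suc n * ((2 * suc n) C suc n) ≡ 2 * (suc (2 * n) * ((2 * n) C n))
  central-binomial-rec n = begin
    suc n * ((2 * suc n) C suc n)                       ≡⟨ cong (λ m → suc n * (m C suc n)) (2*[1+n]) ⟩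
    suc n * (suc (suc (2 * n)) C suc n)                 ≡⟨ cong (suc n *_) (nCk+nC[k+1]≡[n+1]C[k+1] (suc (2 * n)) n) ⟨
    suc n * (suc (2 * n) C n + suc (2 * n) C suc n)     ≡⟨ cong (λ z → suc n * (z + suc (2 * n) C suc n)) symmetric ⟩
    suc n * (suc (2 * n) C suc n + suc (2 * n) C suc n) ≡⟨ double (suc n) (suc (2 * n) C suc n) ⟩
    2 * (suc n * (suc (2 * n) C suc n))                 ≡⟨ cong (2 *_) (C-absorb (2 * n) n) ⟩
    2 * (suc (2 * n) * ((2 * n) C n))                   ∎
    where
    open ≡-Reasoning
    2*[1+n] : 2 * suc n ≡ suc (suc (2 * n))
    2*[1+n] = ℕP.*-suc 2 n
    double : ∀ m x → m * (x + x) ≡ 2 * (m * x)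
    double = ℕ-Solver.solve-∀
    symmetric : suc (2 * n) C n ≡ suc (2 * n) C suc n
    symmetric = trans (nCk≡nC[n∸k] n≤1+2n) (cong (suc (2 * n) C_) 1+2n∸n≡1+n)
      where
      n≤1+2n : n ≤ suc (2 * n)
      n≤1+2n = ℕP.m≤n⇒m≤1+n (ℕP.m≤m+n n (n + 0))
      1+2n∸n≡1+n : suc (2 * n) ∸ n ≡ suc n
      1+2n∸n≡1+n = trans (ℕP.+-∸-assoc 1 (ℕP.m≤m+n n (n + 0))) (cong suc (trans (ℕP.m+n∸m≡n n (n + 0)) (ℕP.+-identityʳ n)))

  catalanℕ-rec : ∀ n → suc (suc n) * catalanℕ (suc n) ≡ 2 * suc (2 * n) * catalanℕ n
  catalanℕ-rec n = ℕP.*-cancelˡ-≡ _ _ (suc n) (begin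
    suc n * (suc (suc n) * catalanℕ (suc n))   ≡⟨ cong (suc n *_) (suc-*-catalanℕ (suc n)) ⟩
    suc n * ((2 * suc n) C suc n)              ≡⟨ central-binomial-rec n ⟩
    2 * (suc (2 * n) * ((2 * n) C n))          ≡⟨ cong (λ z → 2 * (suc (2 * n) * z)) (suc-*-catalanℕ n) ⟨
    2 * (suc (2 * n) * (suc n * catalanℕ n))   ≡⟨ rearrange n (catalanℕ n) ⟩
    suc n * (2 * suc (2 * n) * catalanℕ n)     ∎)
    where
    open ≡-Reasoning
    rearrange : ∀ n c → 2 * (suc (2 * n) * (suc n * c)) ≡ suc n * (2 * suc (2 * n) * c)
    rearrange = ℕ-Solver.solve-∀

open CatalanNumbers using (catalanℕ; catalanℕ-rec)

open import Data.Integer as ℤ using (ℤ; +_; -_; _+_; _*_)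
import Data.Integer.Properties as ℤP
import Data.Integer.Tactic.RingSolver as ℤ-Solver
open import Algebra.Properties.CommutativeSemigroup ℤP.+-commutativeSemigroup using (interchange)

sumTo-cong≤ : ∀ {f g : ℕ → ℤ} n → (∀ i → i ≤ n → f i ≡ g i) → sumTo f n ≡ sumTo g n
sumTo-cong≤ zero    f≡g = f≡g 0 z≤n
sumTo-cong≤ (suc n) f≡g =
  cong₂ _+_ (sumTo-cong≤ n (λ i i≤n → f≡g i (ℕP.m≤n⇒m≤1+n i≤n))) (f≡g (suc n) ℕP.≤-refl)

sumTo-cong : ∀ {f g : ℕ → ℤ} n → (∀ i → f i ≡ g i) → sumTo f n ≡ sumTo g n
sumTo-cong n f≡g = sumTo-cong≤ n (λ i _ → f≡g i)

sumTo-zero : ∀ {f : ℕ → ℤ} n → (∀ i → i ≤ n → f i ≡ + 0) → sumTo f n ≡ + 0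
sumTo-zero zero    f≡0 = f≡0 0 z≤n
sumTo-zero (suc n) f≡0 =
  cong₂ _+_ (sumTo-zero n (λ i i≤n → f≡0 i (ℕP.m≤n⇒m≤1+n i≤n))) (f≡0 (suc n) ℕP.≤-refl)

sumTo-distrib-+ : ∀ (f g : ℕ → ℤ) n → sumTo (λ i → f i + g i) n ≡ sumTo f n + sumTo g n
sumTo-distrib-+ f g zero    = refl
sumTo-distrib-+ f g (suc n) =
  trans (cong (_+ (f (suc n) + g (suc n))) (sumTo-distrib-+ f g n)) (interchange (sumTo f n) (sumTo g n) (f (suc n)) (g (suc n)))

*-distribˡ-sumTo : ∀ c (f : ℕ → ℤ) n → c * sumTo f n ≡ sumTo (λ i → c * f i) n
*-distribˡ-sumTo c f zero    = refl
*-distribˡ-sumTo c f (suc n) =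
  trans (ℤP.*-distribˡ-+ c (sumTo f n) (f (suc n))) (cong (_+ c * f (suc n)) (*-distribˡ-sumTo c f n))

sumTo-suc : ∀ (f : ℕ → ℤ) n → sumTo f (suc n) ≡ f 0 + sumTo (λ i → f (suc i)) n
sumTo-suc f zero    = refl
sumTo-suc f (suc n) =
  trans (cong (_+ f (suc (suc n))) (sumTo-suc f n)) (ℤP.+-assoc (f 0) _ _)

sumTo-reverse : ∀ (f : ℕ → ℤ) n → sumTo f n ≡ sumTo (λ i → f (n ∸ i)) n
sumTo-reverse f zero    = refl
sumTo-reverse f (suc n) = begin
  sumTo f n + f (suc n)                     ≡⟨ cong (_+ f (suc n)) (sumTo-reverse f n) ⟩
  sumTo (λ i → f (n ∸ i)) n + f (suc n)     ≡⟨ ℤP.+-comm _ (f (suc n)) ⟩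
  f (suc n) + sumTo (λ i → f (n ∸ i)) n     ≡⟨ sumTo-suc (λ i → f (suc n ∸ i)) n ⟨
  sumTo (λ i → f (suc n ∸ i)) (suc n)       ∎
  where open ≡-Reasoning

sumTo-swap : ∀ (F : ℕ → ℕ → ℤ) n m →
  sumTo (λ i → sumTo (F i) m) n ≡ sumTo (λ j → sumTo (λ i → F i j) n) m
sumTo-swap F zero    m = refl
sumTo-swap F (suc n) m = trans (cong (_+ sumTo (F (suc n)) m) (sumTo-swap F n m))
  (sym (sumTo-distrib-+ (λ j → sumTo (λ i → F i j) n) (F (suc n)) m))

sumTo-triangle : ∀ (F : ℕ → ℕ → ℤ) n →
  sumTo (λ i → sumTo (λ j → F j i) i) n ≡ sumTo (λ j → sumTo (λ k → F j (j ℕ.+ k)) (n ∸ j)) n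
sumTo-triangle F zero    = refl
sumTo-triangle F (suc n) = begin
  sumTo (λ i → sumTo (λ j → F j i) i) n + sumTo (λ j → F j (suc n)) (suc n)
    ≡⟨ cong (_+ sumTo (λ j → F j (suc n)) (suc n)) (sumTo-triangle F n) ⟩
  Rows n + (sumTo (λ j → F j (suc n)) n + F (suc n) (suc n))
    ≡⟨ ℤP.+-assoc (Rows n) _ _ ⟨
  (Rows n + sumTo (λ j → F j (suc n)) n) + F (suc n) (suc n)
    ≡⟨ cong (_+ F (suc n) (suc n)) (sumTo-distrib-+ (Row n) (λ j → F j (suc n)) n) ⟨
  sumTo (λ j → Row n j + F j (suc n)) n + F (suc n) (suc n)
    ≡⟨ cong₂ _+_ (sumTo-cong≤ n extendRow) lastRow ⟩
  Rows (suc n) ∎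
  where
  open ≡-Reasoning
  Row : ℕ → ℕ → ℤ
  Row n j = sumTo (λ k → F j (j ℕ.+ k)) (n ∸ j)
  Rows : ℕ → ℤ
  Rows n = sumTo (Row n) n
  extendRow : ∀ j → j ≤ n → Row n j + F j (suc n) ≡ Row (suc n) j
  extendRow j j≤n rewrite ℕP.+-∸-assoc 1 j≤n =
    cong (λ m → Row n j + F j m) (trans (cong suc (sym (ℕP.m+[n∸m]≡n j≤n))) (sym (ℕP.+-suc j (n ∸ j))))
  lastRow : F (suc n) (suc n) ≡ Row (suc n) (suc n)
  lastRow rewrite ℕP.n∸n≡0 n | ℕP.+-identityʳ n = refl

sumTo-extend : ∀ (f : ℕ → ℤ) {m n} → m ≤ n → (∀ i → m < i → i ≤ n → f i ≡ + 0) → sumTo f n ≡ sumTo f m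
sumTo-extend f {m} {zero}  z≤n _ = refl
sumTo-extend f {m} {suc n} m≤1+n f≡0 with ℕP.m≤n⇒m<n∨m≡n m≤1+n
... | inj₂ refl = refl
... | inj₁ (s≤s m≤n) = begin
  sumTo f n + f (suc n) ≡⟨ cong (λ z → sumTo f n + z) (f≡0 (suc n) (s≤s m≤n) ℕP.≤-refl) ⟩
  sumTo f n + + 0       ≡⟨ ℤP.+-identityʳ _ ⟩
  sumTo f n             ≡⟨ sumTo-extend f m≤n (λ i m<i i≤n → f≡0 i m<i (ℕP.m≤n⇒m≤1+n i≤n)) ⟩
  sumTo f m             ∎
  where open ≡-Reasoning

infix 4 _≈_
_≈_ : Series → Series → Set
f ≈ g = ∀ n → f n ≡ g n

infixl 6 _⊕_ _⊝_
_⊕_ : Series → Series → Series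
(f ⊕ g) n = f n + g n

infix 8 ⊖_
⊖_ : Series → Series
(⊖ f) n = - f n

_⊝_ : Series → Series → Series
f ⊝ g = f ⊕ ⊖ g

𝟘 : Series
𝟘 _ = + 0

const : ℤ → Series
const c zero    = c
const c (suc _) = + 0

𝟙 : Series
𝟙 = const (+ 1)

const-⊛ : ∀ c f → const c ⊛ f ≈ λ n → c * f n
const-⊛ c f zero    = refl
const-⊛ c f (suc n) = begin
  sumTo (λ i → const c i * f (suc n ∸ i)) (suc n)  ≡⟨ sumTo-suc _ n ⟩
  c * f (suc n) + sumTo (λ i → + 0 * f (n ∸ i)) n  ≡⟨ cong (λ z → c * f (suc n) + z) (sumTo-zero n (λ _ _ → refl)) ⟩
  c * f (suc n) + + 0                              ≡⟨ ℤP.+-identityʳ _ ⟩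
  c * f (suc n)                                    ∎
  where open ≡-Reasoning

⊛-cong : ∀ {f f′ g g′} → f ≈ f′ → g ≈ g′ → f ⊛ g ≈ f′ ⊛ g′
⊛-cong f≈f′ g≈g′ n = sumTo-cong n (λ i → cong₂ _*_ (f≈f′ i) (g≈g′ (n ∸ i)))

⊛-comm : ∀ f g → f ⊛ g ≈ g ⊛ f
⊛-comm f g n = begin
  sumTo (λ i → f i * g (n ∸ i)) n              ≡⟨ sumTo-reverse _ n ⟩
  sumTo (λ i → f (n ∸ i) * g (n ∸ (n ∸ i))) n  ≡⟨ sumTo-cong≤ n swapFactors ⟩
  sumTo (λ i → g i * f (n ∸ i)) n              ∎
  where
  open ≡-Reasoning
  swapFactors : ∀ i → i ≤ n → f (n ∸ i) * g (n ∸ (n ∸ i)) ≡ g i * f (n ∸ i)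
  swapFactors i i≤n rewrite ℕP.m∸[m∸n]≡n i≤n = ℤP.*-comm (f (n ∸ i)) (g i)

⊛-assoc : ∀ f g h → (f ⊛ g) ⊛ h ≈ f ⊛ (g ⊛ h)
⊛-assoc f g h n = begin
  sumTo (λ i → sumTo (λ j → f j * g (i ∸ j)) i * h (n ∸ i)) n
    ≡⟨ sumTo-cong n (λ i → ℤP.*-comm (sumTo _ i) (h (n ∸ i))) ⟩
  sumTo (λ i → h (n ∸ i) * sumTo (λ j → f j * g (i ∸ j)) i) n
    ≡⟨ sumTo-cong n (λ i → *-distribˡ-sumTo (h (n ∸ i)) _ i) ⟩
  sumTo (λ i → sumTo (λ j → h (n ∸ i) * (f j * g (i ∸ j))) i) n
    ≡⟨ sumTo-triangle (λ j i → h (n ∸ i) * (f j * g (i ∸ j))) n ⟩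
  sumTo (λ j → sumTo (λ k → h (n ∸ (j ℕ.+ k)) * (f j * g (j ℕ.+ k ∸ j))) (n ∸ j)) n
    ≡⟨ sumTo-cong n (λ j → sumTo-cong (n ∸ j) (reassociate j)) ⟩
  sumTo (λ j → sumTo (λ k → f j * (g k * h (n ∸ j ∸ k))) (n ∸ j)) n
    ≡⟨ sumTo-cong n (λ j → *-distribˡ-sumTo (f j) _ (n ∸ j)) ⟨
  sumTo (λ j → f j * sumTo (λ k → g k * h (n ∸ j ∸ k)) (n ∸ j)) n ∎
  where
  open ≡-Reasoning
  reassociate : ∀ j k → h (n ∸ (j ℕ.+ k)) * (f j * g (j ℕ.+ k ∸ j)) ≡ f j * (g k * h (n ∸ j ∸ k))
  reassociate j k rewrite ℕP.m+n∸m≡n j k | sym (ℕP.∸-+-assoc n j k) =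
    trans (ℤP.*-comm (h (n ∸ j ∸ k)) _) (ℤP.*-assoc (f j) (g k) _)

⊕-cong : ∀ {f f′ g g′} → f ≈ f′ → g ≈ g′ → f ⊕ g ≈ f′ ⊕ g′
⊕-cong f≈f′ g≈g′ n = cong₂ _+_ (f≈f′ n) (g≈g′ n)

⊕-congˡ : ∀ f {g g′} → g ≈ g′ → f ⊕ g ≈ f ⊕ g′
⊕-congˡ f g≈g′ n = cong (λ z → f n + z) (g≈g′ n)

⊝-congˡ : ∀ f {g g′} → g ≈ g′ → f ⊝ g ≈ f ⊝ g′
⊝-congˡ f g≈g′ n = cong (λ z → f n + - z) (g≈g′ n)

⊛-congˡ : ∀ f {g g′} → g ≈ g′ → f ⊛ g ≈ f ⊛ g′
⊛-congˡ f = ⊛-cong {f} (λ _ → refl)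

⊛-congʳ : ∀ g {f f′} → f ≈ f′ → f ⊛ g ≈ f′ ⊛ g
⊛-congʳ g f≈f′ = ⊛-cong {g = g} f≈f′ (λ _ → refl)

⊛-identityˡ : ∀ f → 𝟙 ⊛ f ≈ f
⊛-identityˡ f n = trans (const-⊛ (+ 1) f n) (ℤP.*-identityˡ (f n))

⊛-identityʳ : ∀ f → f ⊛ 𝟙 ≈ f
⊛-identityʳ f n = trans (⊛-comm f 𝟙 n) (⊛-identityˡ f n)

⊛-distribˡ-⊕ : ∀ f g h → f ⊛ (g ⊕ h) ≈ f ⊛ g ⊕ f ⊛ h
⊛-distribˡ-⊕ f g h n =
  trans (sumTo-cong n (λ i → ℤP.*-distribˡ-+ (f i) (g (n ∸ i)) (h (n ∸ i)))) (sumTo-distrib-+ _ _ n)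

⊛-distribʳ-⊕ : ∀ f g h → (g ⊕ h) ⊛ f ≈ g ⊛ f ⊕ h ⊛ f
⊛-distribʳ-⊕ f g h n = begin
  ((g ⊕ h) ⊛ f) n        ≡⟨ ⊛-comm (g ⊕ h) f n ⟩
  (f ⊛ (g ⊕ h)) n        ≡⟨ ⊛-distribˡ-⊕ f g h n ⟩
  (f ⊛ g) n + (f ⊛ h) n  ≡⟨ cong₂ _+_ (⊛-comm f g n) (⊛-comm f h n) ⟩
  (g ⊛ f) n + (h ⊛ f) n  ∎
  where open ≡-Reasoning

seriesRing : CommutativeRing 0ℓ 0ℓ
seriesRing = record
  { Carrier = Series ; _≈_ = _≈_ ; _+_ = _⊕_ ; _*_ = _⊛_ ; -_ = ⊖_ ; 0# = 𝟘 ; 1# = 𝟙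
  ; isCommutativeRing = record
    { isRing = record
      { +-isAbelianGroup = Pointwise.isAbelianGroup ℤP.+-0-isAbelianGroup
      ; *-cong           = ⊛-cong
      ; *-assoc          = ⊛-assoc
      ; *-identity       = ⊛-identityˡ , ⊛-identityʳ
      ; distrib          = ⊛-distribˡ-⊕ , ⊛-distribʳ-⊕
      }
    ; *-comm = ⊛-comm
    }
  }

open CommutativeRing seriesRing
  using ()
  renaming (refl to ≈-refl; sym to ≈-sym; trans to ≈-trans)

open import Algebra.Properties.Semiring.Exp (CommutativeRing.semiring seriesRing) using (_^_; ^-congˡ)
open import Algebra.Properties.CommutativeSemiring.Exp (CommutativeRing.commutativeSemiring seriesRing)
  using (^-distrib-*)

const-homomorphism :
  CommutativeRing.rawRing ℤP.+-*-commutativeRing -Raw-AlmostCommutative⟶ fromCommutativeRing seriesRing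
const-homomorphism = record
  { ⟦_⟧    = const
  ; +-homo = λ a b → λ { zero → refl ; (suc _) → refl }
  ; *-homo = λ a b → λ { zero → refl ; (suc n) → trans (sym (ℤP.*-zeroʳ a)) (sym (const-⊛ a (const b) (suc n))) }
  ; -‿homo = λ a → λ { zero → refl ; (suc _) → refl }
  ; 0-homo = λ { zero → refl ; (suc _) → refl }
  ; 1-homo = λ _ → refl
  }

const-≟ : ∀ a b → Maybe (const a ≈ const b)
const-≟ a b with a ℤ.≟ b
... | yes refl = just (λ _ → refl)
... | no _     = nothing

open RingSolver (CommutativeRing.rawRing ℤP.+-*-commutativeRing) (fromCommutativeRing seriesRing)
  const-homomorphism const-≟
  using (solve; _:=_; _:+_; _:*_; _:-_; :-_; con; _:^_)


module ≈-Reasoning = SetoidReasoning (CommutativeRing.setoid seriesRing)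

X : Series
X = poly (+ 0 ∷ + 1 ∷ [])

X⊛-suc : ∀ f n → (X ⊛ f) (suc n) ≡ f n
X⊛-suc f n = begin
  (X ⊛ f) (suc n)                              ≡⟨ sumTo-suc _ n ⟩
  + 0 + sumTo (λ i → X (suc i) * f (n ∸ i)) n  ≡⟨ ℤP.+-identityˡ _ ⟩
  sumTo (λ i → X (suc i) * f (n ∸ i)) n        ≡⟨ sumTo-cong n (λ { zero → refl ; (suc _) → refl }) ⟩
  (𝟙 ⊛ f) n                                    ≡⟨ ⊛-identityˡ f n ⟩
  f n                                          ∎
  where open ≡-Reasoning

poly-∷ : ∀ c cs → poly (c ∷ cs) ≈ const c ⊕ X ⊛ poly cs
poly-∷ c cs zero    = sym (ℤP.+-identityʳ c)
poly-∷ c cs (suc n) = sym (trans (ℤP.+-identityˡ _) (X⊛-suc (poly cs) n))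

horner : List ℤ → Series
horner []       = const (+ 0)
horner (c ∷ cs) = const c ⊕ X ⊛ horner cs

poly≈horner : ∀ cs → poly cs ≈ horner cs
poly≈horner []       zero    = refl
poly≈horner []       (suc _) = refl
poly≈horner (c ∷ cs)         = ≈-trans (poly-∷ c cs) (⊕-congˡ (const c) (⊛-congˡ X (poly≈horner cs)))

invAux-step : ∀ g {m n} → m < suc n → invAux g (suc n) m ≡ invAux g n m
invAux-step g {m} {n} m<1+n with m ℕ.≡ᵇ suc n in eq
... | false = refl
... | true  = contradiction (ℕP.≡ᵇ⇒≡ m (suc n) (subst T (sym eq) tt)) (ℕP.<⇒≢ m<1+n)

invAux-stable : ∀ g {m} n → m ≤ n → invAux g n m ≡ inv g m
invAux-stable g zero    z≤n = refl
invAux-stable g (suc n) m≤1+n with ℕP.m≤n⇒m<n∨m≡n m≤1+n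
... | inj₂ refl      = refl
... | inj₁ (s≤s m≤n) = trans (invAux-step g (s≤s m≤n)) (invAux-stable g n m≤n)

inv-suc : ∀ g n → inv g (suc n) ≡ - sumTo (λ j → g (suc j) * inv g (n ∸ j)) n
inv-suc g n with n ℕ.≡ᵇ n | ℕP.≡⇒≡ᵇ n n refl
... | true | _ = cong -_ (sumTo-cong n (λ j → cong (g (suc j) *_) (invAux-stable g n (ℕP.m∸n≤m n j))))

⊛-inverseʳ : ∀ g → g 0 ≡ + 1 → g ⊛ inv g ≈ 𝟙
⊛-inverseʳ g g0≡1 zero    = cong (_* + 1) g0≡1
⊛-inverseʳ g g0≡1 (suc n) = begin
  (g ⊛ inv g) (suc n)     ≡⟨ sumTo-suc _ n ⟩
  g 0 * inv g (suc n) + S ≡⟨ cong₂ (λ a b → a * b + S) g0≡1 (inv-suc g n) ⟩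
  + 1 * - S + S           ≡⟨ cong (_+ S) (ℤP.*-identityˡ (- S)) ⟩
  - S + S                 ≡⟨ ℤP.+-inverseˡ S ⟩
  + 0                     ∎
  where
  open ≡-Reasoning
  S = sumTo (λ j → g (suc j) * inv g (n ∸ j)) n

⊛-cancelˡ : ∀ {r f g} → r 0 ≡ + 1 → r ⊛ f ≈ r ⊛ g → f ≈ g
⊛-cancelˡ {r} {f} {g} r0≡1 rf≈rg = begin
  f                   ≈⟨ ⊛-identityˡ f ⟨
  𝟙 ⊛ f               ≈⟨ ⊛-congʳ f inv-r⊛r ⟨
  inv r ⊛ r ⊛ f       ≈⟨ ⊛-assoc (inv r) r f ⟩
  inv r ⊛ (r ⊛ f)     ≈⟨ ⊛-congˡ (inv r) rf≈rg ⟩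
  inv r ⊛ (r ⊛ g)     ≈⟨ ⊛-assoc (inv r) r g ⟨
  inv r ⊛ r ⊛ g       ≈⟨ ⊛-congʳ g inv-r⊛r ⟩
  𝟙 ⊛ g               ≈⟨ ⊛-identityˡ g ⟩
  g                   ∎
  where
  open ≈-Reasoning
  inv-r⊛r : inv r ⊛ r ≈ 𝟙
  inv-r⊛r = ≈-trans (⊛-comm (inv r) r) (⊛-inverseʳ r r0≡1)

infix 4 x^_∣_
x^_∣_ : ℕ → Series → Set
x^ k ∣ f = ∀ i → i < k → f i ≡ + 0

x^∣-⊛ : ∀ {f g} a b → x^ a ∣ f → x^ b ∣ g → x^ (a ℕ.+ b) ∣ f ⊛ g
x^∣-⊛ {f} {g} a b a∣f b∣g k k<a+b = sumTo-zero k term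
  where
  term : ∀ i → i ≤ k → f i * g (k ∸ i) ≡ + 0
  term i i≤k with i ℕP.<? a
  ... | yes i<a = trans (cong (_* g (k ∸ i)) (a∣f i i<a)) (ℤP.*-zeroˡ (g (k ∸ i)))
  ... | no  i≮a = trans (cong (f i *_) (b∣g (k ∸ i) k∸i<b)) (ℤP.*-zeroʳ (f i))
    where
    k∸i<b : k ∸ i < b
    k∸i<b = ℕP.+-cancelˡ-< i (k ∸ i) b (ℕP.<-≤-trans
      (subst (_< a ℕ.+ b) (sym (ℕP.m+[n∸m]≡n i≤k)) k<a+b)
      (ℕP.+-monoˡ-≤ b (ℕP.≮⇒≥ i≮a)))

x^∣-pow : ∀ {f} k → x^ 1 ∣ f → x^ k ∣ pow f k
x^∣-pow zero    _   i ()
x^∣-pow (suc k) x∣f = x^∣-⊛ 1 k x∣f (x^∣-pow k x∣f)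

x^∣-^ : ∀ {f} k → x^ 1 ∣ f → x^ k ∣ f ^ k
x^∣-^ zero    _   i ()
x^∣-^ (suc k) x∣f = x^∣-⊛ 1 k x∣f (x^∣-^ k x∣f)

-- Substitution of u = x/(1-x)

oneMinusX≈ : oneMinusX ≈ 𝟙 ⊝ X
oneMinusX≈ zero          = refl
oneMinusX≈ (suc zero)    = refl
oneMinusX≈ (suc (suc _)) = refl

u≈X⊛geom : u ≈ X ⊛ geom
u≈X⊛geom zero    = refl
u≈X⊛geom (suc n) = sym (X⊛-suc geom n)

oneMinusX⊛geom : oneMinusX ⊛ geom ≈ 𝟙
oneMinusX⊛geom = ≈-trans (⊛-congʳ geom oneMinusX≈)
  (≈-trans (solve 2 (λ x γ → (con (+ 1) :- x) :* γ := γ :- x :* γ) (λ _ → refl) X geom) telescope)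
  where
  telescope : geom ⊝ X ⊛ geom ≈ 𝟙
  telescope zero    = refl
  telescope (suc n) = cong (λ z → + 1 + - z) (X⊛-suc geom n)

oneMinusX⊛u : oneMinusX ⊛ u ≈ X
oneMinusX⊛u = begin
  oneMinusX ⊛ u             ≈⟨ ⊛-congˡ oneMinusX u≈X⊛geom ⟩
  oneMinusX ⊛ (X ⊛ geom)    ≈⟨ solve 3 (λ y x γ → y :* (x :* γ) := x :* (y :* γ)) (λ _ → refl) oneMinusX X geom ⟩
  X ⊛ (oneMinusX ⊛ geom)    ≈⟨ ⊛-congˡ X oneMinusX⊛geom ⟩
  X ⊛ 𝟙                     ≈⟨ ⊛-identityʳ X ⟩
  X                         ∎
  where open ≈-Reasoning

u⊛-suc : ∀ f m → (u ⊛ f) (suc m) ≡ sumTo (λ i → f (m ∸ i)) m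
u⊛-suc f m = trans (sumTo-suc _ m) (trans (ℤP.+-identityˡ _) (sumTo-cong m (λ i → ℤP.*-identityˡ _)))

x∣u : x^ 1 ∣ u
x∣u zero    _          = refl
x∣u (suc _) (s≤s ())

compU-cong : ∀ {f g} → f ≈ g → compU f ≈ compU g
compU-cong f≈g n = sumTo-cong n (λ k → cong (_* pow u k n) (f≈g k))

compU-⊕ : ∀ f g → compU (f ⊕ g) ≈ compU f ⊕ compU g
compU-⊕ f g n =
  trans (sumTo-cong n (λ k → ℤP.*-distribʳ-+ (pow u k n) (f k) (g k))) (sumTo-distrib-+ _ _ n)

compU-const⊛ : ∀ c f → compU (const c ⊛ f) ≈ const c ⊛ compU f
compU-const⊛ c f n = begin
  sumTo (λ k → (const c ⊛ f) k * pow u k n) n  ≡⟨ sumTo-cong n scale ⟩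
  sumTo (λ k → c * (f k * pow u k n)) n        ≡⟨ *-distribˡ-sumTo c _ n ⟨
  c * compU f n                                ≡⟨ const-⊛ c (compU f) n ⟨
  (const c ⊛ compU f) n                        ∎
  where
  open ≡-Reasoning
  scale : ∀ k → (const c ⊛ f) k * pow u k n ≡ c * (f k * pow u k n)
  scale k = trans (cong (_* pow u k n) (const-⊛ c f k)) (ℤP.*-assoc c (f k) (pow u k n))

compU-⊝ : ∀ f g → compU (f ⊝ g) ≈ compU f ⊝ compU g
compU-⊝ f g = begin
  compU (f ⊝ g)                           ≈⟨ compU-cong (solve 2 (λ f g → f :- g := f :+ con (- + 1) :* g) (λ _ → refl) f g) ⟩
  compU (f ⊕ const (- + 1) ⊛ g)           ≈⟨ compU-⊕ f _ ⟩
  compU f ⊕ compU (const (- + 1) ⊛ g)     ≈⟨ ⊕-congˡ (compU f) (compU-const⊛ (- + 1) g) ⟩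
  compU f ⊕ const (- + 1) ⊛ compU g       ≈⟨ solve 2 (λ F G → F :+ con (- + 1) :* G := F :- G) (λ _ → refl) (compU f) (compU g) ⟩
  compU f ⊝ compU g                       ∎
  where open ≈-Reasoning

compU-𝟙 : compU 𝟙 ≈ 𝟙
compU-𝟙 zero    = refl
compU-𝟙 (suc n) = trans (sumTo-suc _ n) (cong (λ z → + 0 + z) (sumTo-zero n (λ _ _ → refl)))

compU-X⊛ : ∀ f → compU (X ⊛ f) ≈ u ⊛ compU f
compU-X⊛ f zero    = refl
compU-X⊛ f (suc m) = begin
  compU (X ⊛ f) (suc m)
    ≡⟨ trans (sumTo-suc _ m) (ℤP.+-identityˡ _) ⟩
  sumTo (λ k → (X ⊛ f) (suc k) * pow u (suc k) (suc m)) m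
    ≡⟨ sumTo-cong m (λ k → cong₂ _*_ (X⊛-suc f k) (u⊛-suc (pow u k) m)) ⟩
  sumTo (λ k → f k * sumTo (λ i → pow u k (m ∸ i)) m) m
    ≡⟨ sumTo-cong m (λ k → *-distribˡ-sumTo (f k) _ m) ⟩
  sumTo (λ k → sumTo (λ i → f k * pow u k (m ∸ i)) m) m
    ≡⟨ sumTo-swap (λ k i → f k * pow u k (m ∸ i)) m m ⟩
  sumTo (λ i → sumTo (λ k → f k * pow u k (m ∸ i)) m) m
    ≡⟨ sumTo-cong m (λ i → sumTo-extend _ (ℕP.m∸n≤m m i) (λ k m∸i<k _ → vanishing k (m ∸ i) m∸i<k)) ⟩
  sumTo (λ i → compU f (m ∸ i)) m
    ≡⟨ u⊛-suc (compU f) m ⟨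
  (u ⊛ compU f) (suc m) ∎
  where
  open ≡-Reasoning
  vanishing : ∀ k n → n < k → f k * pow u k n ≡ + 0
  vanishing k n n<k = trans (cong (f k *_) (x^∣-pow k x∣u n n<k)) (ℤP.*-zeroʳ (f k))

compU-X^⊛ : ∀ k f → compU (X ^ k ⊛ f) ≈ u ^ k ⊛ compU f
compU-X^⊛ zero    f = ≈-trans (compU-cong (⊛-identityˡ f)) (≈-sym (⊛-identityˡ (compU f)))
compU-X^⊛ (suc k) f = begin
  compU (X ⊛ X ^ k ⊛ f)      ≈⟨ compU-cong (⊛-assoc X (X ^ k) f) ⟩
  compU (X ⊛ (X ^ k ⊛ f))    ≈⟨ compU-X⊛ (X ^ k ⊛ f) ⟩
  u ⊛ compU (X ^ k ⊛ f)      ≈⟨ ⊛-congˡ u (compU-X^⊛ k f) ⟩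
  u ⊛ (u ^ k ⊛ compU f)      ≈⟨ ⊛-assoc u (u ^ k) (compU f) ⟨
  u ⊛ u ^ k ⊛ compU f        ∎
  where open ≈-Reasoning

compU-rational : ∀ a k g → g ⊛ (𝟙 ⊝ X ^ k) ≈ 𝟙 ⊕ const a ⊛ X →
  compU g ⊛ (𝟙 ⊝ u ^ k) ≈ 𝟙 ⊕ const a ⊛ u
compU-rational a k g g-eq = begin
  compU g ⊛ (𝟙 ⊝ u ^ k)              ≈⟨ solve 2 (λ G Q → G :* (con (+ 1) :- Q) := G :- Q :* G) (λ _ → refl) (compU g) (u ^ k) ⟩
  compU g ⊝ u ^ k ⊛ compU g          ≈⟨ ⊕-congˡ (compU g) (λ n → cong -_ (compU-X^⊛ k g n)) ⟨
  compU g ⊝ compU (X ^ k ⊛ g)        ≈⟨ compU-⊝ g (X ^ k ⊛ g) ⟨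
  compU (g ⊝ X ^ k ⊛ g)              ≈⟨ compU-cong (solve 2 (λ g Q → g :- Q :* g := g :* (con (+ 1) :- Q)) (λ _ → refl) g (X ^ k)) ⟩
  compU (g ⊛ (𝟙 ⊝ X ^ k))            ≈⟨ compU-cong g-eq ⟩
  compU (𝟙 ⊕ const a ⊛ X)            ≈⟨ compU-⊕ 𝟙 (const a ⊛ X) ⟩
  compU 𝟙 ⊕ compU (const a ⊛ X)      ≈⟨ ⊕-cong compU-𝟙 (compU-const⊛ a X) ⟩
  𝟙 ⊕ const a ⊛ compU X              ≈⟨ ⊕-congˡ 𝟙 (⊛-congˡ (const a) compU-X) ⟩
  𝟙 ⊕ const a ⊛ u                    ∎
  where
  open ≈-Reasoning
  compU-X : compU X ≈ u
  compU-X = begin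
    compU X              ≈⟨ compU-cong (⊛-identityʳ X) ⟨
    compU (X ⊛ 𝟙)        ≈⟨ compU-X⊛ 𝟙 ⟩
    u ⊛ compU 𝟙          ≈⟨ ⊛-congˡ u compU-𝟙 ⟩
    u ⊛ 𝟙                ≈⟨ ⊛-identityʳ u ⟩
    u                    ∎

-- Defs.t g n k = (column₀ g ⊛ pow u k) n by definition.
column₀ : Series → Series
column₀ g = geom ⊛ inv (compU g)

column₀-rational : ∀ a j g → g 0 ≡ + 1 → g ⊛ (𝟙 ⊝ X ^ suc j) ≈ 𝟙 ⊕ const a ⊛ X →
  oneMinusX ^ suc j ⊛ (oneMinusX ⊕ const a ⊛ X) ⊛ column₀ g ≈ oneMinusX ^ suc j ⊝ X ^ suc j
column₀-rational a j g g0≡1 g-eq = begin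
  Y ⊛ P ⊛ (Y ⊕ A ⊛ X) ⊛ (geom ⊛ V)
    ≈⟨ ⊛-congʳ (geom ⊛ V) (⊛-congˡ (Y ⊛ P) numerator) ⟩
  Y ⊛ P ⊛ (Y ⊛ (G ⊛ (𝟙 ⊝ Q))) ⊛ (geom ⊛ V)
    ≈⟨ solve 6 (λ y p g q γ v → y :* p :* (y :* (g :* (con (+ 1) :- q))) :* (γ :* v)
                              := (y :* γ) :* (g :* v) :* (y :* p :- y :* p :* q))
             (λ _ → refl) Y P G Q geom V ⟩
  (Y ⊛ geom) ⊛ (G ⊛ V) ⊛ (Y ^ suc j ⊝ Y ^ suc j ⊛ Q)
    ≈⟨ ⊛-cong (⊛-cong oneMinusX⊛geom (⊛-inverseʳ G G0≡1)) (⊕-congˡ (Y ^ suc j) (λ n → cong -_ (powers n))) ⟩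
  𝟙 ⊛ 𝟙 ⊛ (Y ^ suc j ⊝ X ^ suc j)
    ≈⟨ solve 1 (λ r → con (+ 1) :* con (+ 1) :* r := r) (λ _ → refl) (Y ^ suc j ⊝ X ^ suc j) ⟩
  Y ^ suc j ⊝ X ^ suc j ∎
  where
  open ≈-Reasoning
  Y = oneMinusX
  A = const a
  P = Y ^ j
  G = compU g
  V = inv G
  Q = u ^ suc j
  G0≡1 : G 0 ≡ + 1
  G0≡1 = trans (ℤP.*-identityʳ (g 0)) g0≡1
  numerator : Y ⊕ A ⊛ X ≈ Y ⊛ (G ⊛ (𝟙 ⊝ Q))
  numerator = begin
    Y ⊕ A ⊛ X            ≈⟨ ⊕-congˡ Y (⊛-congˡ A oneMinusX⊛u) ⟨
    Y ⊕ A ⊛ (Y ⊛ u)      ≈⟨ solve 3 (λ y c v → y :+ c :* (y :* v) := y :* (con (+ 1) :+ c :* v)) (λ _ → refl) Y A u ⟩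
    Y ⊛ (𝟙 ⊕ A ⊛ u)      ≈⟨ ⊛-congˡ Y (compU-rational a (suc j) g g-eq) ⟨
    Y ⊛ (G ⊛ (𝟙 ⊝ Q))    ∎
  powers : Y ^ suc j ⊛ Q ≈ X ^ suc j
  powers = ≈-trans (≈-sym (^-distrib-* Y u (suc j))) (^-congˡ (suc j) oneMinusX⊛u)

-- The Euler operator θ = x d/dx and the Catalan equation

θ : Series → Series
θ f n = + n * f n

θ-⊝ : ∀ f g → θ (f ⊝ g) ≈ θ f ⊝ θ g
θ-⊝ f g n = trans (ℤP.*-distribˡ-+ (+ n) (f n) (- g n)) (cong (λ z → + n * f n + z) (sym (ℤP.neg-distribʳ-* (+ n) (g n))))

θ-𝟙⊕ : ∀ f → θ (𝟙 ⊕ f) ≈ θ f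
θ-𝟙⊕ f zero    = refl
θ-𝟙⊕ f (suc n) = cong (+ suc n *_) (ℤP.+-identityˡ (f (suc n)))

θ-X : θ X ≈ X
θ-X zero          = refl
θ-X (suc zero)    = refl
θ-X (suc (suc n)) = ℤP.*-zeroʳ (+ suc (suc n))

θ-⊛ : ∀ f g → θ (f ⊛ g) ≈ θ f ⊛ g ⊕ f ⊛ θ g
θ-⊛ f g n = begin
  + n * sumTo (λ i → f i * g (n ∸ i)) n
    ≡⟨ *-distribˡ-sumTo (+ n) _ n ⟩
  sumTo (λ i → + n * (f i * g (n ∸ i))) n
    ≡⟨ sumTo-cong≤ n leibniz ⟩
  sumTo (λ i → + i * f i * g (n ∸ i) + f i * (+ (n ∸ i) * g (n ∸ i))) n
    ≡⟨ sumTo-distrib-+ _ _ n ⟩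
  (θ f ⊛ g ⊕ f ⊛ θ g) n ∎
  where
  open ≡-Reasoning
  split : ∀ i j x y → (i + j) * (x * y) ≡ i * x * y + x * (j * y)
  split = ℤ-Solver.solve-∀
  leibniz : ∀ i → i ≤ n → + n * (f i * g (n ∸ i)) ≡ + i * f i * g (n ∸ i) + f i * (+ (n ∸ i) * g (n ∸ i))
  leibniz i i≤n = begin
    + n * (f i * g (n ∸ i))                 ≡⟨ cong (λ m → + m * (f i * g (n ∸ i))) (ℕP.m+[n∸m]≡n i≤n) ⟨
    + (i ℕ.+ (n ∸ i)) * (f i * g (n ∸ i))   ≡⟨ cong (_* (f i * g (n ∸ i))) (ℤP.pos-+ i (n ∸ i)) ⟩
    (+ i + + (n ∸ i)) * (f i * g (n ∸ i))   ≡⟨ split (+ i) (+ (n ∸ i)) (f i) (g (n ∸ i)) ⟩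
    + i * f i * g (n ∸ i) + f i * (+ (n ∸ i) * g (n ∸ i)) ∎

θ-ode⇒≈𝟘 : ∀ k E → θ E ⊕ E ≈ const k ⊛ (X ⊛ θ E) → E ≈ 𝟘
θ-ode⇒≈𝟘 k E ode zero    = trans (sym (ℤP.+-identityˡ (E 0))) (trans (ode 0) (ℤP.*-zeroʳ k))
θ-ode⇒≈𝟘 k E ode (suc m) = [2+m]E≡0⇒E≡0 (begin
  + suc (suc m) * E (suc m)              ≡⟨ ℤP.*-distribʳ-+ (E (suc m)) (+ 1) (+ suc m) ⟩
  + 1 * E (suc m) + + suc m * E (suc m)  ≡⟨ trans (cong (_+ θ E (suc m)) (ℤP.*-identityˡ (E (suc m)))) (ℤP.+-comm (E (suc m)) _) ⟩
  (θ E ⊕ E) (suc m)                      ≡⟨ ode (suc m) ⟩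
  (const k ⊛ (X ⊛ θ E)) (suc m)          ≡⟨ trans (const-⊛ k (X ⊛ θ E) (suc m)) (cong (k *_) (X⊛-suc (θ E) m)) ⟩
  k * (+ m * E m)                        ≡⟨ cong (λ z → k * (+ m * z)) (θ-ode⇒≈𝟘 k E ode m) ⟩
  k * (+ m * + 0)                        ≡⟨ cong (k *_) (ℤP.*-zeroʳ (+ m)) ⟩
  k * + 0                                ≡⟨ ℤP.*-zeroʳ k ⟩
  + 0                                    ∎)
  where
  open ≡-Reasoning
  [2+m]E≡0⇒E≡0 : + suc (suc m) * E (suc m) ≡ + 0 → E (suc m) ≡ + 0
  [2+m]E≡0⇒E≡0 eq with ℤP.i*j≡0⇒i≡0∨j≡0 (+ suc (suc m)) eq
  ... | inj₂ E≡0 = E≡0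

catalan-ode : catalan ⊕ θ catalan ≈ 𝟙 ⊕ X ⊛ (const (+ 4) ⊛ θ catalan ⊕ const (+ 2) ⊛ catalan)
catalan-ode zero    = refl
catalan-ode (suc m) = begin
  + c′ + + suc m * + c′                 ≡⟨ cong (λ z → + c′ + z) (ℤP.pos-* (suc m) c′) ⟨
  + (suc (suc m) ℕ.* c′)                ≡⟨ cong +_ (catalanℕ-rec m) ⟩
  + (2 ℕ.* suc (2 ℕ.* m) ℕ.* c)         ≡⟨ cong +_ (split m c) ⟩
  + (4 ℕ.* (m ℕ.* c) ℕ.+ 2 ℕ.* c)       ≡⟨ ℤP.pos-+ (4 ℕ.* (m ℕ.* c)) (2 ℕ.* c) ⟩
  + (4 ℕ.* (m ℕ.* c)) + + (2 ℕ.* c)     ≡⟨ cong₂ _+_ (trans (ℤP.pos-* 4 (m ℕ.* c)) (cong (+ 4 *_) (ℤP.pos-* m c))) (ℤP.pos-* 2 c) ⟩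
  + 4 * (+ m * + c) + + 2 * + c         ≡⟨ cong₂ _+_ (const-⊛ (+ 4) (θ catalan) m) (const-⊛ (+ 2) catalan m) ⟨
  F m                                   ≡⟨ X⊛-suc F m ⟨
  (X ⊛ F) (suc m)                       ≡⟨ ℤP.+-identityˡ _ ⟨
  (𝟙 ⊕ X ⊛ F) (suc m)                   ∎
  where
  open ≡-Reasoning
  c = catalanℕ m
  c′ = catalanℕ (suc m)
  F = const (+ 4) ⊛ θ catalan ⊕ const (+ 2) ⊛ catalan
  split : ∀ m c → 2 ℕ.* suc (2 ℕ.* m) ℕ.* c ≡ 4 ℕ.* (m ℕ.* c) ℕ.+ 2 ℕ.* c
  split = ℕ-Solver.solve-∀

catalan-defect : Series
catalan-defect = catalan ⊝ (𝟙 ⊕ X ⊛ catalan ⊛ catalan)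

θ-catalan-defect : let c = catalan ; D = θ catalan in
  θ catalan-defect ≈ D ⊝ ((X ⊛ c ⊕ X ⊛ D) ⊛ c ⊕ X ⊛ c ⊛ D)
θ-catalan-defect = ≈-trans (θ-⊝ c _) (⊝-congˡ (θ c) (≈-trans (θ-𝟙⊕ _) (≈-trans (θ-⊛ (X ⊛ c) c)
  (⊕-cong (⊛-congʳ c (≈-trans (θ-⊛ X c) (⊕-cong (⊛-congʳ c θ-X) ≈-refl))) ≈-refl))))
  where c = catalan

catalan-defect-ode : θ catalan-defect ⊕ catalan-defect ≈ const (+ 4) ⊛ (X ⊛ θ catalan-defect)
catalan-defect-ode = begin
  θ E ⊕ E
    ≈⟨ solve 3 (λ x t e → t :+ e := con (+ 4) :* (x :* t) :+ ((con (+ 1) :- con (+ 4) :* x) :* t :+ e)) (λ _ → refl) X (θ E) E ⟩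
  const (+ 4) ⊛ (X ⊛ θ E) ⊕ ((𝟙 ⊝ const (+ 4) ⊛ X) ⊛ θ E ⊕ E)
    ≈⟨ ⊕-congˡ (const (+ 4) ⊛ (X ⊛ θ E)) vanishing ⟩
  const (+ 4) ⊛ (X ⊛ θ E) ⊕ 𝟘
    ≈⟨ (λ n → ℤP.+-identityʳ _) ⟩
  const (+ 4) ⊛ (X ⊛ θ E) ∎
  where
  open ≈-Reasoning
  c = catalan
  D = θ catalan
  E = catalan-defect
  F = const (+ 4) ⊛ D ⊕ const (+ 2) ⊛ c
  vanishing : (𝟙 ⊝ const (+ 4) ⊛ X) ⊛ θ E ⊕ E ≈ 𝟘
  vanishing = begin
    (𝟙 ⊝ const (+ 4) ⊛ X) ⊛ θ E ⊕ E
      ≈⟨ ⊕-cong (⊛-congˡ (𝟙 ⊝ const (+ 4) ⊛ X) θ-catalan-defect) ≈-refl ⟩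
    (𝟙 ⊝ const (+ 4) ⊛ X) ⊛ (D ⊝ ((X ⊛ c ⊕ X ⊛ D) ⊛ c ⊕ X ⊛ c ⊛ D)) ⊕ E
      ≈⟨ solve 3 (λ x c d →
           (con (+ 1) :- con (+ 4) :* x) :* (d :- ((x :* c :+ x :* d) :* c :+ x :* c :* d))
             :+ (c :- (con (+ 1) :+ x :* c :* c))
           := (con (+ 1) :- con (+ 2) :* x :* c)
                :* ((c :+ d) :- (con (+ 1) :+ x :* (con (+ 4) :* d :+ con (+ 2) :* c))))
           (λ _ → refl) X c D ⟩
    (𝟙 ⊝ const (+ 2) ⊛ X ⊛ c) ⊛ ((c ⊕ D) ⊝ (𝟙 ⊕ X ⊛ F))
      ≈⟨ ⊛-congˡ (𝟙 ⊝ const (+ 2) ⊛ X ⊛ c) (λ n → cong (λ z → z + - (𝟙 ⊕ X ⊛ F) n) (catalan-ode n)) ⟩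
    (𝟙 ⊝ const (+ 2) ⊛ X ⊛ c) ⊛ ((𝟙 ⊕ X ⊛ F) ⊝ (𝟙 ⊕ X ⊛ F))
      ≈⟨ solve 2 (λ r s → r :* (s :- s) := con (+ 0)) (λ _ → refl) (𝟙 ⊝ const (+ 2) ⊛ X ⊛ c) (𝟙 ⊕ X ⊛ F) ⟩
    const (+ 0)
      ≈⟨ (λ { zero → refl ; (suc _) → refl }) ⟩
    𝟘 ∎

catalan-equation : catalan ≈ 𝟙 ⊕ X ⊛ catalan ⊛ catalan
catalan-equation = begin
  c                          ≈⟨ solve 2 (λ c x → c := (c :- (con (+ 1) :+ x :* c :* c)) :+ (con (+ 1) :+ x :* c :* c)) (λ _ → refl) c X ⟩
  catalan-defect ⊕ (𝟙 ⊕ X ⊛ c ⊛ c)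
                             ≈⟨ ⊕-cong (θ-ode⇒≈𝟘 (+ 4) catalan-defect catalan-defect-ode) ≈-refl ⟩
  𝟘 ⊕ (𝟙 ⊕ X ⊛ c ⊛ c)        ≈⟨ (λ n → ℤP.+-identityˡ _) ⟩
  𝟙 ⊕ X ⊛ c ⊛ c              ∎
  where
  open ≈-Reasoning
  c = catalan

-- Central coefficients

w : Series
w = X ⊛ catalan

[𝟙⊝w]⊛catalan : (𝟙 ⊝ w) ⊛ catalan ≈ 𝟙
[𝟙⊝w]⊛catalan = begin
  (𝟙 ⊝ X ⊛ c) ⊛ c                        ≈⟨ solve 2 (λ x c → (con (+ 1) :- x :* c) :* c := c :- x :* c :* c) (λ _ → refl) X c ⟩
  c ⊝ X ⊛ c ⊛ c                          ≈⟨ ⊕-cong catalan-equation ≈-refl ⟩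
  𝟙 ⊕ X ⊛ c ⊛ c ⊝ X ⊛ c ⊛ c              ≈⟨ solve 2 (λ x c → con (+ 1) :+ x :* c :* c :- x :* c :* c := con (+ 1)) (λ _ → refl) X c ⟩
  𝟙                                      ∎
  where
  open ≈-Reasoning
  c = catalan

w⊛w≈w⊝X : w ⊛ w ≈ w ⊝ X
w⊛w≈w⊝X = begin
  X ⊛ c ⊛ (X ⊛ c)              ≈⟨ solve 2 (λ x c → x :* c :* (x :* c) := x :* (con (+ 1) :+ x :* c :* c) :- x) (λ _ → refl) X c ⟩
  X ⊛ (𝟙 ⊕ X ⊛ c ⊛ c) ⊝ X      ≈⟨ ⊕-cong (⊛-congˡ X catalan-equation) ≈-refl ⟨
  X ⊛ c ⊝ X                    ∎
  where
  open ≈-Reasoning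
  c = catalan

x∣w : x^ 1 ∣ w
x∣w zero    _          = refl
x∣w (suc _) (s≤s ())

column : Series → ℕ → Series
column F k = F ⊛ pow u k

-- centralTransform g is definitionally central (column₀ g).
central : Series → Series
central F n = column F n (2 ℕ.* n)

x^k∣column : ∀ F k → x^ k ∣ column F k
x^k∣column F k = x^∣-⊛ {F} 0 k (λ _ ()) (x^∣-pow k x∣u)

column-pascal : ∀ F k → column F (suc k) ≈ X ⊛ (column F (suc k) ⊕ column F k)
column-pascal F k = begin
  F ⊛ (u ⊛ P)                                   ≈⟨ solve 4 (λ f v p x → f :* (v :* p) := (con (+ 1) :- x) :* v :* (f :* p) :+ x :* (f :* (v :* p))) (λ _ → refl) F u P X ⟩
  (𝟙 ⊝ X) ⊛ u ⊛ (F ⊛ P) ⊕ X ⊛ (F ⊛ (u ⊛ P))     ≈⟨ ⊕-cong (⊛-congʳ (F ⊛ P) [𝟙⊝X]⊛u) ≈-refl ⟩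
  X ⊛ (F ⊛ P) ⊕ X ⊛ (F ⊛ (u ⊛ P))               ≈⟨ solve 4 (λ f v p x → x :* (f :* p) :+ x :* (f :* (v :* p)) := x :* (f :* (v :* p) :+ f :* p)) (λ _ → refl) F u P X ⟩
  X ⊛ (F ⊛ (u ⊛ P) ⊕ F ⊛ P)                     ∎
  where
  open ≈-Reasoning
  P = pow u k
  [𝟙⊝X]⊛u : (𝟙 ⊝ X) ⊛ u ≈ X
  [𝟙⊝X]⊛u = ≈-trans (⊛-congʳ u (≈-sym oneMinusX≈)) oneMinusX⊛u

w^-step : ∀ s B → w ^ suc s ⊛ B ≈ w ^ suc (suc s) ⊛ B ⊕ X ⊛ (w ^ s ⊛ B)
w^-step s B = begin
  w ⊛ P ⊛ B                    ≈⟨ ⊛-congʳ B (⊛-congʳ P (≈-trans (solve 2 (λ w x → w := (w :- x) :+ x) (λ _ → refl) w X) (⊕-cong (≈-sym w⊛w≈w⊝X) ≈-refl))) ⟩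
  (w ⊛ w ⊕ X) ⊛ P ⊛ B          ≈⟨ solve 4 (λ w x p b → (w :* w :+ x) :* p :* b := w :* (w :* p) :* b :+ x :* (p :* b)) (λ _ → refl) w X P B ⟩
  w ⊛ (w ⊛ P) ⊛ B ⊕ X ⊛ (P ⊛ B) ∎
  where
  open ≈-Reasoning
  P = w ^ s

column-suc : ∀ F k N → column F (suc k) (suc N) ≡ column F (suc k) N + column F k N
column-suc F k N = trans (column-pascal F k (suc N)) (X⊛-suc (column F (suc k) ⊕ column F k) N)

w^-suc : ∀ s B m → (w ^ suc s ⊛ B) (suc m) ≡ (w ^ suc (suc s) ⊛ B) (suc m) + (w ^ s ⊛ B) m
w^-suc s B m = trans (w^-step s B (suc m)) (cong (λ z → (w ^ suc (suc s) ⊛ B) (suc m) + z) (X⊛-suc (w ^ s ⊛ B) m))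

-- Both sides obey the same recursion: Pascal's rule on the left, w^(s+1) = w^(s+2) + x w^s on the right.
column-central     : ∀ F s d → column F (s ℕ.+ d) (s ℕ.+ d ℕ.+ d) ≡ (w ^ s ⊛ central F) (s ℕ.+ d)
column-subdiagonal : ∀ F s d → column F (suc (s ℕ.+ d)) (s ℕ.+ d ℕ.+ d) ≡ (w ^ suc (suc s) ⊛ central F) (suc (s ℕ.+ d))

column-central F zero    d = trans (cong (column F d) (cong (d ℕ.+_) (sym (ℕP.+-identityʳ d))))
                                   (sym (⊛-identityˡ (central F) d))
column-central F (suc s) d = begin
  column F (suc (s ℕ.+ d)) (suc (s ℕ.+ d ℕ.+ d))
    ≡⟨ column-suc F (s ℕ.+ d) (s ℕ.+ d ℕ.+ d) ⟩
  column F (suc (s ℕ.+ d)) (s ℕ.+ d ℕ.+ d) + column F (s ℕ.+ d) (s ℕ.+ d ℕ.+ d)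
    ≡⟨ cong₂ _+_ (column-subdiagonal F s d) (column-central F s d) ⟩
  (w ^ suc (suc s) ⊛ central F) (suc (s ℕ.+ d)) + (w ^ s ⊛ central F) (s ℕ.+ d)
    ≡⟨ w^-suc s (central F) (s ℕ.+ d) ⟨
  (w ^ suc s ⊛ central F) (suc (s ℕ.+ d)) ∎
  where open ≡-Reasoning

column-subdiagonal F s zero = trans
  (x^k∣column F (suc (s ℕ.+ 0)) _ (s≤s (ℕP.≤-reflexive (ℕP.+-identityʳ (s ℕ.+ 0)))))
  (sym (x^∣-⊛ {w ^ suc (suc s)} {central F} (suc (suc s)) 0 (x^∣-^ (suc (suc s)) x∣w) (λ _ ()) _ (ℕP.n<1+n _)))
column-subdiagonal F s (suc d) rewrite ℕP.+-suc s d | ℕP.+-suc (s ℕ.+ d) d =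
  column-central F (suc (suc s)) d

central-X⊛ : ∀ F → central (X ⊛ F) ≈ w ⊛ central F
central-X⊛ F zero    = refl
central-X⊛ F (suc m) = begin
  ((X ⊛ F) ⊛ pow u (suc m)) (2 ℕ.* suc m)     ≡⟨ ⊛-assoc X F (pow u (suc m)) (2 ℕ.* suc m) ⟩
  (X ⊛ column F (suc m)) (suc (m ℕ.+ suc (m ℕ.+ 0))) ≡⟨ X⊛-suc (column F (suc m)) (m ℕ.+ suc (m ℕ.+ 0)) ⟩
  column F (suc m) (m ℕ.+ suc (m ℕ.+ 0))      ≡⟨ cong (column F (suc m)) (trans (ℕP.+-suc m (m ℕ.+ 0)) (cong (λ k → suc (m ℕ.+ k)) (ℕP.+-identityʳ m))) ⟩
  column F (1 ℕ.+ m) (1 ℕ.+ m ℕ.+ m)          ≡⟨ column-central F 1 m ⟩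
  (w ^ 1 ⊛ central F) (suc m)                 ≡⟨ ⊛-congʳ (central F) (⊛-identityʳ w) (suc m) ⟩
  (w ⊛ central F) (suc m)                     ∎
  where open ≡-Reasoning

central-cong : ∀ {F G} → F ≈ G → central F ≈ central G
central-cong F≈G n = ⊛-congʳ (pow u n) F≈G (2 ℕ.* n)

central-⊕ : ∀ F G → central (F ⊕ G) ≈ central F ⊕ central G
central-⊕ F G n = ⊛-distribʳ-⊕ (pow u n) F G (2 ℕ.* n)

central-const⊛ : ∀ c F → central (const c ⊛ F) ≈ const c ⊛ central F
central-const⊛ c F n = begin
  (const c ⊛ F ⊛ pow u n) (2 ℕ.* n)     ≡⟨ ⊛-assoc (const c) F (pow u n) (2 ℕ.* n) ⟩
  (const c ⊛ column F n) (2 ℕ.* n)      ≡⟨ const-⊛ c (column F n) (2 ℕ.* n) ⟩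
  c * central F n                       ≡⟨ const-⊛ c (central F) n ⟨
  (const c ⊛ central F) n               ∎
  where open ≡-Reasoning

central-⊝ : ∀ F G → central (F ⊝ G) ≈ central F ⊝ central G
central-⊝ F G = begin
  central (F ⊝ G)                          ≈⟨ central-cong (solve 2 (λ f g → f :- g := f :+ con (- + 1) :* g) (λ _ → refl) F G) ⟩
  central (F ⊕ const (- + 1) ⊛ G)          ≈⟨ ≈-trans (central-⊕ F _) (⊕-congˡ (central F) (central-const⊛ (- + 1) G)) ⟩
  central F ⊕ const (- + 1) ⊛ central G    ≈⟨ solve 2 (λ f g → f :+ con (- + 1) :* g := f :- g) (λ _ → refl) (central F) (central G) ⟩
  central F ⊝ central G                    ∎
  where open ≈-Reasoning

central-oneMinusX⊛ : ∀ F → central (oneMinusX ⊛ F) ≈ (𝟙 ⊝ w) ⊛ central F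
central-oneMinusX⊛ F = begin
  central (oneMinusX ⊛ F)          ≈⟨ central-cong (⊛-congʳ F oneMinusX≈) ⟩
  central ((𝟙 ⊝ X) ⊛ F)            ≈⟨ central-cong (solve 2 (λ x f → (con (+ 1) :- x) :* f := f :- x :* f) (λ _ → refl) X F) ⟩
  central (F ⊝ X ⊛ F)              ≈⟨ central-⊝ F (X ⊛ F) ⟩
  central F ⊝ central (X ⊛ F)      ≈⟨ ⊝-congˡ (central F) (central-X⊛ F) ⟩
  central F ⊝ w ⊛ central F        ≈⟨ solve 2 (λ w b → b :- w :* b := (con (+ 1) :- w) :* b) (λ _ → refl) w (central F) ⟩
  (𝟙 ⊝ w) ⊛ central F              ∎
  where open ≈-Reasoning

central-^⊛ : ∀ P Q → (∀ F → central (P ⊛ F) ≈ Q ⊛ central F) → ∀ k F → central (P ^ k ⊛ F) ≈ Q ^ k ⊛ central F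
central-^⊛ P Q P↦Q zero    F = ≈-trans (central-cong (⊛-identityˡ F)) (≈-sym (⊛-identityˡ (central F)))
central-^⊛ P Q P↦Q (suc k) F = begin
  central (P ⊛ P ^ k ⊛ F)        ≈⟨ central-cong (⊛-assoc P (P ^ k) F) ⟩
  central (P ⊛ (P ^ k ⊛ F))      ≈⟨ P↦Q (P ^ k ⊛ F) ⟩
  Q ⊛ central (P ^ k ⊛ F)        ≈⟨ ⊛-congˡ Q (central-^⊛ P Q P↦Q k F) ⟩
  Q ⊛ (Q ^ k ⊛ central F)        ≈⟨ ⊛-assoc Q (Q ^ k) (central F) ⟨
  Q ⊛ Q ^ k ⊛ central F          ∎
  where open ≈-Reasoning

central-rational : ∀ a j g → g 0 ≡ + 1 → g ⊛ (𝟙 ⊝ X ^ suc j) ≈ 𝟙 ⊕ const a ⊛ X →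
  (𝟙 ⊝ w) ^ suc j ⊛ ((𝟙 ⊝ w) ⊕ const a ⊛ w) ⊛ centralTransform g ≈ ((𝟙 ⊝ w) ^ suc j ⊝ w ^ suc j) ⊛ central 𝟙
central-rational a j g g0≡1 g-eq = begin
  W ^ k ⊛ (W ⊕ A ⊛ w) ⊛ central h
    ≈⟨ solve 5 (λ p W A w b → p :* (W :+ A :* w) :* b := p :* (W :* b :+ A :* (w :* b))) (λ _ → refl) (W ^ k) W A w (central h) ⟩
  W ^ k ⊛ (W ⊛ central h ⊕ A ⊛ (w ⊛ central h))
    ≈⟨ ⊛-congˡ (W ^ k) (⊕-cong (≈-sym (central-oneMinusX⊛ h)) (≈-trans (⊛-congˡ A (≈-sym (central-X⊛ h))) (≈-sym (central-const⊛ a (X ⊛ h))))) ⟩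
  W ^ k ⊛ (central (Y ⊛ h) ⊕ central (A ⊛ (X ⊛ h)))
    ≈⟨ ⊛-congˡ (W ^ k) (≈-sym (central-⊕ (Y ⊛ h) (A ⊛ (X ⊛ h)))) ⟩
  W ^ k ⊛ central (Y ⊛ h ⊕ A ⊛ (X ⊛ h))
    ≈⟨ central-^⊛ Y W central-oneMinusX⊛ k (Y ⊛ h ⊕ A ⊛ (X ⊛ h)) ⟨
  central (Y ^ k ⊛ (Y ⊛ h ⊕ A ⊛ (X ⊛ h)))
    ≈⟨ central-cong (solve 5 (λ p y A x h → p :* (y :* h :+ A :* (x :* h)) := p :* (y :+ A :* x) :* h) (λ _ → refl) (Y ^ k) Y A X h) ⟩
  central (Y ^ k ⊛ (Y ⊕ A ⊛ X) ⊛ h)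
    ≈⟨ central-cong (column₀-rational a j g g0≡1 g-eq) ⟩
  central (Y ^ k ⊝ X ^ k)
    ≈⟨ central-cong (⊕-cong (≈-sym (⊛-identityʳ (Y ^ k))) (λ n → cong -_ (sym (⊛-identityʳ (X ^ k) n)))) ⟩
  central (Y ^ k ⊛ 𝟙 ⊝ X ^ k ⊛ 𝟙)
    ≈⟨ ≈-trans (central-⊝ (Y ^ k ⊛ 𝟙) (X ^ k ⊛ 𝟙)) (⊕-cong (central-^⊛ Y W central-oneMinusX⊛ k 𝟙) (λ n → cong -_ (central-^⊛ X w central-X⊛ k 𝟙 n))) ⟩
  W ^ k ⊛ central 𝟙 ⊝ w ^ k ⊛ central 𝟙
    ≈⟨ solve 3 (λ p q b → p :* b :- q :* b := (p :- q) :* b) (λ _ → refl) (W ^ k) (w ^ k) (central 𝟙) ⟩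
  (W ^ k ⊝ w ^ k) ⊛ central 𝟙 ∎
  where
  open ≈-Reasoning
  k = suc j
  W = 𝟙 ⊝ w
  A = const a
  Y = oneMinusX
  h = column₀ g

linear-quotient : ∀ a P {Q} → P 0 ≡ + 1 → P ≈ Q → poly (+ 1 ∷ a ∷ []) ⊛ inv P ⊛ Q ≈ 𝟙 ⊕ const a ⊛ X
linear-quotient a P {Q} P0≡1 P≈Q = begin
  N ⊛ inv P ⊛ Q               ≈⟨ ⊛-congˡ (N ⊛ inv P) P≈Q ⟨
  N ⊛ inv P ⊛ P               ≈⟨ solve 3 (λ n i p → n :* i :* p := n :* (p :* i)) (λ _ → refl) N (inv P) P ⟩
  N ⊛ (P ⊛ inv P)             ≈⟨ ⊛-congˡ N (⊛-inverseʳ P P0≡1) ⟩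
  N ⊛ 𝟙                       ≈⟨ ⊛-identityʳ N ⟩
  N                           ≈⟨ poly≈horner (+ 1 ∷ a ∷ []) ⟩
  horner (+ 1 ∷ a ∷ [])       ≈⟨ solve 2 (λ A x → con (+ 1) :+ x :* (A :+ x :* con (+ 0)) := con (+ 1) :+ A :* x) (λ _ → refl) (const a) X ⟩
  𝟙 ⊕ const a ⊛ X             ∎
  where
  open ≈-Reasoning
  N = poly (+ 1 ∷ a ∷ [])

g₂-equation : ∀ a → g₂ a ⊛ (𝟙 ⊝ X ^ 2) ≈ 𝟙 ⊕ const a ⊛ X
g₂-equation a = linear-quotient a _ refl (≈-trans (poly≈horner (+ 1 ∷ + 0 ∷ - + 1 ∷ []))
  (solve 1 (λ x → con (+ 1) :+ x :* (con (+ 0) :+ x :* (con (- + 1) :+ x :* con (+ 0))) := con (+ 1) :- x :^ 2) (λ _ → refl) X))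

g₃-equation : ∀ a → g₃ a ⊛ (𝟙 ⊝ X ^ 3) ≈ 𝟙 ⊕ const a ⊛ X
g₃-equation a = linear-quotient a _ refl (≈-trans (poly≈horner (+ 1 ∷ + 0 ∷ + 0 ∷ - + 1 ∷ []))
  (solve 1 (λ x → con (+ 1) :+ x :* (con (+ 0) :+ x :* (con (+ 0) :+ x :* (con (- + 1) :+ x :* con (+ 0)))) := con (+ 1) :- x :^ 3) (λ _ → refl) X))

oneMinusX⊛[W²⊝w²] : oneMinusX ⊛ ((𝟙 ⊝ w) ^ 2 ⊝ w ^ 2) ≈ (𝟙 ⊝ w) ^ 3 ⊝ w ^ 3
oneMinusX⊛[W²⊝w²] = begin
  oneMinusX ⊛ ((𝟙 ⊝ w) ^ 2 ⊝ w ^ 2)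
    ≈⟨ ⊛-congʳ ((𝟙 ⊝ w) ^ 2 ⊝ w ^ 2) oneMinusX≈ ⟩
  (𝟙 ⊝ X) ⊛ ((𝟙 ⊝ w) ^ 2 ⊝ w ^ 2)
    ≈⟨ solve 2 (λ x w → (con (+ 1) :- x) :* ((con (+ 1) :- w) :^ 2 :- w :^ 2)
                      := (con (+ 1) :- w) :^ 3 :- w :^ 3 :- (con (+ 1) :- con (+ 2) :* w) :* (w :* w :- (w :- x)))
             (λ _ → refl) X w ⟩
  (𝟙 ⊝ w) ^ 3 ⊝ w ^ 3 ⊝ (𝟙 ⊝ const (+ 2) ⊛ w) ⊛ (w ⊛ w ⊝ (w ⊝ X))
    ≈⟨ ⊝-congˡ ((𝟙 ⊝ w) ^ 3 ⊝ w ^ 3) (⊛-congˡ (𝟙 ⊝ const (+ 2) ⊛ w) (⊕-cong {g = ⊖ (w ⊝ X)} w⊛w≈w⊝X ≈-refl)) ⟩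
  (𝟙 ⊝ w) ^ 3 ⊝ w ^ 3 ⊝ (𝟙 ⊝ const (+ 2) ⊛ w) ⊛ ((w ⊝ X) ⊝ (w ⊝ X))
    ≈⟨ solve 3 (λ c t r → c :- t :* (r :- r) := c) (λ _ → refl) ((𝟙 ⊝ w) ^ 3 ⊝ w ^ 3) (𝟙 ⊝ const (+ 2) ⊛ w) (w ⊝ X) ⟩
  (𝟙 ⊝ w) ^ 3 ⊝ w ^ 3 ∎
  where open ≈-Reasoning

mainTheorem8 : (a : ℤ) → (n : ℕ) →
    centralTransform (g₃ a) n ≡ (oneMinusX ⊛ catalan ⊛ centralTransform (g₂ a)) n
mainTheorem8 a = ⊛-cancelˡ {R} R0≡1 (begin
  R ⊛ C₃
    ≈⟨ central-rational a 2 (g₃ a) refl (g₃-equation a) ⟩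
  (W ^ 3 ⊝ w ^ 3) ⊛ central 𝟙
    ≈⟨ ⊛-congʳ (central 𝟙) oneMinusX⊛[W²⊝w²] ⟨
  oneMinusX ⊛ (W ^ 2 ⊝ w ^ 2) ⊛ central 𝟙
    ≈⟨ ≈-trans (⊛-congˡ oneMinusX (central-rational a 1 (g₂ a) refl (g₂-equation a))) (≈-sym (⊛-assoc oneMinusX (W ^ 2 ⊝ w ^ 2) (central 𝟙))) ⟨
  oneMinusX ⊛ (W ^ 2 ⊛ (W ⊕ A ⊛ w) ⊛ C₂)
    ≈⟨ ⊛-congʳ (W ^ 2 ⊛ (W ⊕ A ⊛ w) ⊛ C₂) (≈-trans (⊛-congˡ oneMinusX [𝟙⊝w]⊛catalan) (⊛-identityʳ oneMinusX)) ⟨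
  oneMinusX ⊛ (W ⊛ catalan) ⊛ (W ^ 2 ⊛ (W ⊕ A ⊛ w) ⊛ C₂)
    ≈⟨ solve 6 (λ y W c A w b → y :* (W :* c) :* (W :^ 2 :* (W :+ A :* w) :* b) := W :^ 3 :* (W :+ A :* w) :* (y :* c :* b))
             (λ _ → refl) oneMinusX W catalan A w C₂ ⟩
  R ⊛ (oneMinusX ⊛ catalan ⊛ C₂)
    ∎)
  where
  open ≈-Reasoning
  W = 𝟙 ⊝ w
  A = const a
  R = W ^ 3 ⊛ (W ⊕ A ⊛ w)
  C₂ = centralTransform (g₂ a)
  C₃ = centralTransform (g₃ a)
  R0≡1 : R 0 ≡ + 1
  R0≡1 = cong (λ z → + 1 * (+ 1 + z)) (ℤP.*-zeroʳ a)
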